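{- Let $d$ be a positive square-free integer, $\mathcal{O}_d$ the ring of integers of $\mathbb{Q}(\sqrt{ -d})$, and $t\in\mathcal{O}_d$ with $t\neq\pm 4i$. Then the equation \[ F_t(x,y) = x^4 - t x^3 y - 6 x^2 y^2 + t x y^3 + y^4 = 0, \qquad x,y\in\mathcal{O}_d, \] has only the solution $(x,y)=(0,0)$. -}

module Defs where

open import Data.Nat as ℕ using (ℕ; _%_; _≡ᵇ_)
open import Data.Nat.Divisibility as ℕD using ()
open import Data.Integer as ℤ using (ℤ; +_; -_; _+_; _*_)
open import Data.Bool using (if_then_else_)
open import Relation.Binary.PropositionalEquality using (_≡_)

SquareFree : ℕ → Set
SquareFree d = ∀ (n : ℕ) → (n ℕ.* n) ℕD.∣ d → n ≡ 1

-- Elements of O_d = ring of integers of Q(√-d), written a + b·ω in the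
-- standard integral basis {1, ω}:
--   ω = (1 + √-d)/2  if d ≡ 3 (mod 4)   (i.e. -d ≡ 1 mod 4), ω² = ω - (1+d)/4
--   ω = √-d          otherwise (d ≡ 1,2 mod 4 for square-free d), ω² = -d
record O : Set where
  constructor mk
  field
    re : ℤ
    im : ℤ
open O public

-- ω² = p + q·ω ; returns p and q
ω²-p : ℕ → ℤ
ω²-p d = if (d % 4) ≡ᵇ 3 then - (+ ((d ℕ.+ 1) ℕ./ 4)) else - (+ d)

ω²-q : ℕ → ℤ
ω²-q d = if (d % 4) ≡ᵇ 3 then + 1 else + 0

0O : O
0O = mk (+ 0) (+ 0)

fromℤ : ℤ → O
fromℤ a = mk a (+ 0)

addO : O → O → O
addO (mk a b) (mk c e) = mk (a + c) (b + e)

negO : O → O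
negO (mk a b) = mk (- a) (- b)

subO : O → O → O
subO x y = addO x (negO y)

-- (a + bω)(c + eω) = ac + (ae + bc)ω + be ω²
mulO : ℕ → O → O → O
mulO d (mk a b) (mk c e) =
  mk (a * c + b * e * ω²-p d) (a * e + b * c + b * e * ω²-q d)

F : ℕ → O → O → O → O
F d t x y =
  let _·_ = mulO d
      x2 = x · x
      y2 = y · y
      x3 = x2 · x
      y3 = y2 · y
  in addO (subO (subO (x2 · x2) (t · (x3 · y)))
                (fromℤ (+ 6) · (x2 · y2)))
          (addO (t · (x · y3)) (y2 · y2))

-- If F_t(x, y) = 0, then x/y and y/x are roots of monic quartics over O_d.
-- Integrality is used through norms only: yᵏ divides xᵏ·x³ for every k, so
-- N(y)ᵏ divides N(x)ᵏ·N(x)³ for every k, whence N(y) ∣ N(x); symmetrically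
-- N(x) ∣ N(y), so N(x) = N(y) (and y = 0 forces x = 0).  The Möbius map
-- (x, y) ↦ (x + y, x − y) sends zeros of F_t to zeros of F_{−t}, so also
-- N(x + y) = N(x − y), and by the parallelogram law Tr(x·ȳ) = 0.  Then
-- ȳ²(x² + y²) = (xȳ)² + N(xȳ) = 0, and eliminating x between F_t and x² + y²
-- leaves y²(t² + 16) = 0.  Finally t² = −16 in O_d with d square-free forces
-- d = 1 and t = ±4i.

module Submission where

open import Defs
open import Algebra.Bundles using (CommutativeRing; Semiring)
open import Algebra.Structures using (IsCommutativeRing)
open import Tactic.RingSolver.Core.AlmostCommutativeRing using (fromCommutativeRing)
import Tactic.RingSolver.NonReflective
import Algebra.Definitions.RawSemiring
open import Data.Bool using (true; false; T)
open import Data.Integer as ℤ using (ℤ; +_; -_; -[1+_]; ∣_∣)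
import Data.Integer.Properties as ℤP
import Data.Maybe as Maybe
open import Data.Nat as ℕ using (ℕ; zero; suc; NonZero; _≥_)
import Data.Nat.DivMod as ℕ
import Data.Nat.Divisibility as ℕ
import Data.Nat.Properties as ℕP
open import Data.Product using (_×_; _,_; proj₁; proj₂; ∃-syntax)
open import Data.Sum as Sum using (_⊎_; inj₁; inj₂; [_,_]′)
open import Function using (id)
open import Relation.Binary.PropositionalEquality
open import Relation.Nullary using (Dec; contradiction; yes; no)
open import Relation.Nullary.Decidable using (map′; _×-dec_; dec⇒maybe)

module NatDivisibility where

  open import Data.Nat
  open import Data.Nat.Properties
  open import Data.Nat.Divisibility
  open import Data.Nat.Coprimality as Coprimality using (Coprime; coprime-divisor; 1-coprimeTo; coprime-/gcd)
  open import Data.Nat.GCD using (gcd; gcd[m,n]∣m; gcd[m,n]∣n; gcd[m,n]≢0)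
  open import Data.Nat.DivMod using (_/_; m/n*n≡m)
  open import Data.Nat.Tactic.RingSolver using (solve-∀)

  coprime-*ˡ : ∀ {m n o} → Coprime m o → Coprime n o → Coprime (m * n) o
  coprime-*ˡ {m} m⊥o n⊥o {i} (i∣mn , i∣o) = n⊥o (coprime-divisor i⊥m i∣mn , i∣o)
    where
    i⊥m : Coprime i m
    i⊥m (j∣i , j∣m) = m⊥o (j∣m , ∣-trans j∣i i∣o)

  coprime-^ˡ : ∀ {m n} → Coprime m n → ∀ k → Coprime (m ^ k) n
  coprime-^ˡ {n = n} _   zero    = 1-coprimeTo n
  coprime-^ˡ         m⊥n (suc k) = coprime-*ˡ m⊥n (coprime-^ˡ m⊥n k)

  coprime-^ : ∀ {m n} → Coprime m n → ∀ k → Coprime (m ^ k) (n ^ k)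
  coprime-^ m⊥n k = Coprimality.sym (coprime-^ˡ (Coprimality.sym (coprime-^ˡ m⊥n k)) k)

  ^-distribʳ-* : ∀ m n k → (m * n) ^ k ≡ m ^ k * n ^ k
  ^-distribʳ-* m n zero    = refl
  ^-distribʳ-* m n (suc k) =
    trans (cong (m * n *_) (^-distribʳ-* m n k)) (interchange m n (m ^ k) (n ^ k))
    where
    interchange : ∀ m n a b → m * n * (a * b) ≡ m * a * (n * b)
    interchange = solve-∀

  n<2^n : ∀ n → n < 2 ^ n
  n<2^n zero    = s≤s z≤n
  n<2^n (suc n) = begin-strict
    1 + n         <⟨ +-monoʳ-< 1 (n<2^n n) ⟩
    1 + 2 ^ n     ≤⟨ +-monoˡ-≤ (2 ^ n) (m^n>0 2 n) ⟩
    2 ^ n + 2 ^ n ≡⟨ cong (_+_ (2 ^ n)) (sym (+-identityʳ (2 ^ n))) ⟩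
    2 ^ suc n     ∎
    where open ≤-Reasoning

  -- Writing m = a·g and n = b·g with g = gcd m n, the hypothesis for k = c
  -- gives bᶜ ∣ aᶜ·c, hence bᶜ ∣ c by coprimality, which forces b = 1.
  ^∣^*⇒∣ : ∀ {m n} c .{{_ : NonZero c}} → (∀ k → n ^ k ∣ m ^ k * c) → n ∣ m
  ^∣^*⇒∣ {m} {zero} c h = subst (0 ∣_) (sym m≡0) (0 ∣0)
    where
    m≡0 : m ≡ 0
    m≡0 = trans (sym (*-identityʳ m)) (m*n≡0⇒m≡0 (m * 1) c (0∣⇒≡0 (h 1)))
  ^∣^*⇒∣ {m} {n@(suc _)} c h = subst (_∣ m) g≡n (gcd[m,n]∣m m n)
    where
    g = gcd m n
    instance
      g≢0 : NonZero g
      g≢0 = ≢-nonZero (gcd[m,n]≢0 m n (inj₂ λ ()))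
    a = m / g
    b = n / g
    m≡a*g : m ≡ a * g
    m≡a*g = sym (m/n*n≡m (gcd[m,n]∣m m n))
    n≡b*g : n ≡ b * g
    n≡b*g = sym (m/n*n≡m (gcd[m,n]∣n m n))
    m^c*c≡a^c*c*g^c : m ^ c * c ≡ a ^ c * c * g ^ c
    m^c*c≡a^c*c*g^c = begin
      m ^ c * c           ≡⟨ cong (λ m → m ^ c * c) m≡a*g ⟩
      (a * g) ^ c * c     ≡⟨ cong (_* c) (^-distribʳ-* a g c) ⟩
      a ^ c * g ^ c * c   ≡⟨ swap (a ^ c) (g ^ c) c ⟩
      a ^ c * c * g ^ c   ∎
      where
      open ≡-Reasoning
      swap : ∀ x y z → x * y * z ≡ x * z * y
      swap = solve-∀
    b^c∣c : b ^ c ∣ c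
    b^c∣c = coprime-divisor (coprime-^ (Coprimality.sym (coprime-/gcd m n)) c)
      (*-cancelʳ-∣ (g ^ c) {{m^n≢0 g c}}
        (subst₂ _∣_ (trans (cong (_^ c) n≡b*g) (^-distribʳ-* b g c)) m^c*c≡a^c*c*g^c (h c)))
    b≡1 : b ≡ 1
    b≡1 = bounded-power b (λ b≡0 → 0≢1+n (trans (sym (cong (_* g) b≡0)) (sym n≡b*g))) (∣⇒≤ b^c∣c)
      where
      bounded-power : ∀ b → b ≢ 0 → b ^ c ≤ c → b ≡ 1
      bounded-power zero          b≢0 _     = contradiction refl b≢0
      bounded-power (suc zero)    _   _     = refl
      bounded-power (suc (suc b)) _   b^c≤c =
        contradiction (≤-trans (^-monoˡ-≤ c (s≤s (s≤s z≤n))) b^c≤c) (<⇒≱ (n<2^n c))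
    g≡n : g ≡ n
    g≡n = trans (sym (*-identityˡ g)) (trans (cong (_* g) (sym b≡1)) (sym n≡b*g))

  d*k²≡16⇒d≡1∧k≡4 : ∀ d k .{{_ : NonZero d}} → SquareFree d → d * (k * k) ≡ 16 → d ≡ 1 × k ≡ 4
  d*k²≡16⇒d≡1∧k≡4 d 0 _ e = contradiction (trans (sym (*-zeroʳ d)) e) λ ()
  d*k²≡16⇒d≡1∧k≡4 d 1 sf e = contradiction (sf 2 (divides 4 (trans (sym (*-identityʳ d)) e))) λ ()
  d*k²≡16⇒d≡1∧k≡4 d 2 sf e = contradiction (sf 2 (divides 1 (*-cancelʳ-≡ d 4 4 e))) λ ()
  d*k²≡16⇒d≡1∧k≡4 d 3 _ e = contradiction (n∣m⇒m%n≡0 16 9 (divides d (sym e))) λ ()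
  d*k²≡16⇒d≡1∧k≡4 d 4 _ e = *-cancelʳ-≡ d 1 16 e , refl
  d*k²≡16⇒d≡1∧k≡4 d k@(suc (suc (suc (suc (suc _))))) _ e = contradiction e (>⇒≢ (begin-strict
    16          <⟨ m≤m+n 17 8 ⟩
    5 * 5       ≤⟨ *-mono-≤ 5≤k 5≤k ⟩
    k * k       ≤⟨ m≤n*m (k * k) d ⟩
    d * (k * k) ∎))
    where
    open ≤-Reasoning
    5≤k : 5 ≤ k
    5≤k = s≤s (s≤s (s≤s (s≤s (s≤s z≤n))))

open NatDivisibility using (^∣^*⇒∣; d*k²≡16⇒d≡1∧k≡4)

module Coordinates where

  open import Data.Integer using (ℤ; +_; -_; _+_; _*_; _-_)
  open import Data.Integer.Tactic.RingSolver using (solve-∀)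

  *-assoc-re : ∀ a b c e f g p q →
    (a * c + b * e * p) * f + (a * e + b * c + b * e * q) * g * p
    ≡ a * (c * f + e * g * p) + b * (c * g + e * f + e * g * q) * p
  *-assoc-re = solve-∀

  *-assoc-im : ∀ a b c e f g p q →
    (a * c + b * e * p) * g + (a * e + b * c + b * e * q) * f + (a * e + b * c + b * e * q) * g * q
    ≡ a * (c * g + e * f + e * g * q) + b * (c * f + e * g * p) + b * (c * g + e * f + e * g * q) * q
  *-assoc-im = solve-∀

  *-comm-re : ∀ a b c e p → a * c + b * e * p ≡ c * a + e * b * p
  *-comm-re = solve-∀

  *-comm-im : ∀ a b c e q → a * e + b * c + b * e * q ≡ c * b + e * a + e * b * q
  *-comm-im = solve-∀

  *-identityˡ-re : ∀ a b p → + 1 * a + + 0 * b * p ≡ a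
  *-identityˡ-re = solve-∀

  *-identityˡ-im : ∀ a b q → + 1 * b + + 0 * a + + 0 * b * q ≡ b
  *-identityˡ-im = solve-∀

  *-distribˡ-+-re : ∀ a b c e f g p →
    a * (c + f) + b * (e + g) * p ≡ (a * c + b * e * p) + (a * f + b * g * p)
  *-distribˡ-+-re = solve-∀

  *-distribˡ-+-im : ∀ a b c e f g q →
    a * (e + g) + b * (c + f) + b * (e + g) * q ≡ (a * e + b * c + b * e * q) + (a * g + b * f + b * g * q)
  *-distribˡ-+-im = solve-∀

  fromℤ-*-re : ∀ a b p → a * b + + 0 * + 0 * p ≡ a * b
  fromℤ-*-re = solve-∀

  fromℤ-*-im : ∀ a b q → a * + 0 + + 0 * b + + 0 * + 0 * q ≡ + 0
  fromℤ-*-im = solve-∀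

  norm-* : ∀ a b c e p q →
    (a * c + b * e * p) * (a * c + b * e * p) + q * (a * c + b * e * p) * (a * e + b * c + b * e * q)
      - p * (a * e + b * c + b * e * q) * (a * e + b * c + b * e * q)
    ≡ (a * a + q * a * b - p * b * b) * (c * c + q * c * e - p * e * e)
  norm-* = solve-∀

  norm-conj : ∀ a b p q →
    (a + q * b) * (a + q * b) + q * (a + q * b) * (- b) - p * (- b) * (- b) ≡ a * a + q * a * b - p * b * b
  norm-conj = solve-∀

  norm-fromℤ : ∀ a p q → a * a + q * a * + 0 - p * + 0 * + 0 ≡ a * a
  norm-fromℤ = solve-∀

  *-conj-re : ∀ a b p q → a * (a + q * b) + b * (- b) * p ≡ a * a + q * a * b - p * b * b
  *-conj-re = solve-∀

  *-conj-im : ∀ a b q → a * (- b) + b * (a + q * b) + b * (- b) * q ≡ + 0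
  *-conj-im = solve-∀

  trace-*-conj : ∀ a b c e p q →
    (a * (c + q * e) + b * (- e) * p) + (a * (c + q * e) + b * (- e) * p) + q * (a * (- e) + b * (c + q * e) + b * (- e) * q)
    ≡ ((a + c) * (a + c) + q * (a + c) * (b + e) - p * (b + e) * (b + e))
      - (a * a + q * a * b - p * b * b) - (c * c + q * c * e - p * e * e)
  trace-*-conj = solve-∀

  parallelogram : ∀ a b c e p q →
    ((a + c) * (a + c) + q * (a + c) * (b + e) - p * (b + e) * (b + e))
      + ((a + - c) * (a + - c) + q * (a + - c) * (b + - e) - p * (b + - e) * (b + - e))
    ≡ + 2 * (a * a + q * a * b - p * b * b) + + 2 * (c * c + q * c * e - p * e * e)
  parallelogram = solve-∀

  four*norm : ∀ a b p q →
    + 4 * (a * a + q * a * b - p * b * b) ≡ (a + a + q * b) * (a + a + q * b) - (q * q + + 4 * p) * (b * b)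
  four*norm = solve-∀

  1-4k≡1-k*4 : ∀ k → + 1 * + 1 + + 4 * - k ≡ + 1 - k * + 4
  1-4k≡1-k*4 = solve-∀

  1-[n+1]≡-n : ∀ n → + 1 - (n + + 1) ≡ - n
  1-[n+1]≡-n = solve-∀

  0²+4[-n]≡-[4n] : ∀ n → + 0 * + 0 + + 4 * - n ≡ - (+ 4 * n)
  0²+4[-n]≡-[4n] = solve-∀

  i-[-j]*k≡i+j*k : ∀ i j k → i - (- j) * k ≡ i + j * k
  i-[-j]*k≡i+j*k = solve-∀

  a+a+q*0≡2*a : ∀ a q → a + a + q * + 0 ≡ + 2 * a
  a+a+q*0≡2*a = solve-∀

  i+j≡0⇒i≡-j : ∀ i j → i + j ≡ + 0 → i ≡ - j
  i+j≡0⇒i≡-j i j i+j≡0 = trans (lemma i j) (trans (cong (_- j) i+j≡0) (ℤP.+-identityˡ (- j)))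
    where
    lemma : ∀ i j → i ≡ (i + j) - j
    lemma = solve-∀

  im[t²+16] : ∀ a b q → a * b + b * a + b * b * q + + 0 ≡ b * (a + a + q * b)
  im[t²+16] = solve-∀

  re[t²]-q≡0 : ∀ b p → + 0 * + 0 + b * b * p ≡ p * (b * b)
  re[t²]-q≡0 = solve-∀

  re[t²]-q≡1 : ∀ a p → a * a + (- (a + a)) * (- (a + a)) * p ≡ (+ 1 * + 1 + + 4 * p) * (a * a)
  re[t²]-q≡1 = solve-∀

  a+a+0*b≡2*a : ∀ a b → a + a + + 0 * b ≡ + 2 * a
  a+a+0*b≡2*a = solve-∀

  a+a+1*b≡0⇒b≡-[a+a] : ∀ a b → a + a + + 1 * b ≡ + 0 → b ≡ - (a + a)
  a+a+1*b≡0⇒b≡-[a+a] a b e = i+j≡0⇒i≡-j b (a + a) (trans (lemma a b) e)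
    where
    lemma : ∀ a b → b + (a + a) ≡ a + a + + 1 * b
    lemma = solve-∀

  a+a≡2*n+2*n⇒a-n-n≡0 : ∀ a n → a + a ≡ + 2 * n + + 2 * n → a - n - n ≡ + 0
  a+a≡2*n+2*n⇒a-n-n≡0 a n e = [ (λ ()) , id ]′ (ℤP.i*j≡0⇒i≡0∨j≡0 (+ 2) (begin
    + 2 * (a - n - n)                       ≡⟨ lemma a n ⟩
    a + a - (+ 2 * n + + 2 * n)             ≡⟨ cong (_- (+ 2 * n + + 2 * n)) e ⟩
    + 2 * n + + 2 * n - (+ 2 * n + + 2 * n) ≡⟨ ℤP.+-inverseʳ (+ 2 * n + + 2 * n) ⟩
    + 0                                     ∎))
    where
    open ≡-Reasoning
    lemma : ∀ a n → + 2 * (a - n - n) ≡ a + a - (+ 2 * n + + 2 * n)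
    lemma = solve-∀

_≟_ : (x y : O) → Dec (x ≡ y)
mk a b ≟ mk c e = map′ (λ (a≡c , b≡e) → cong₂ mk a≡c b≡e) (λ x≡y → cong re x≡y , cong im x≡y)
                       (a ℤ.≟ c ×-dec b ℤ.≟ e)

module QuadraticIntegers (d : ℕ) where

  private
    p q : ℤ
    p = ω²-p d
    q = ω²-q d

    mulO-comm : ∀ x y → mulO d x y ≡ mulO d y x
    mulO-comm (mk a b) (mk c e) = cong₂ mk (Coordinates.*-comm-re a b c e p) (Coordinates.*-comm-im a b c e q)

    mulO-identityˡ : ∀ x → mulO d (fromℤ (+ 1)) x ≡ x
    mulO-identityˡ (mk a b) = cong₂ mk (Coordinates.*-identityˡ-re a b p) (Coordinates.*-identityˡ-im a b q)

    mulO-distribˡ-addO : ∀ x y z → mulO d x (addO y z) ≡ addO (mulO d x y) (mulO d x z)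
    mulO-distribˡ-addO (mk a b) (mk c e) (mk f g) =
      cong₂ mk (Coordinates.*-distribˡ-+-re a b c e f g p) (Coordinates.*-distribˡ-+-im a b c e f g q)

  isCommutativeRing : IsCommutativeRing _≡_ addO (mulO d) negO 0O (fromℤ (+ 1))
  isCommutativeRing = record
    { isRing = record
      { +-isAbelianGroup = record
        { isGroup = record
          { isMonoid = record
            { isSemigroup = record
              { isMagma = record { isEquivalence = isEquivalence ; ∙-cong = cong₂ addO }
              ; assoc = λ { (mk a b) (mk c e) (mk f g) → cong₂ mk (ℤP.+-assoc a c f) (ℤP.+-assoc b e g) } }
            ; identity = (λ { (mk a b) → cong₂ mk (ℤP.+-identityˡ a) (ℤP.+-identityˡ b) })
                       , (λ { (mk a b) → cong₂ mk (ℤP.+-identityʳ a) (ℤP.+-identityʳ b) }) }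
          ; inverse = (λ { (mk a b) → cong₂ mk (ℤP.+-inverseˡ a) (ℤP.+-inverseˡ b) })
                    , (λ { (mk a b) → cong₂ mk (ℤP.+-inverseʳ a) (ℤP.+-inverseʳ b) })
          ; ⁻¹-cong = cong negO }
        ; comm = λ { (mk a b) (mk c e) → cong₂ mk (ℤP.+-comm a c) (ℤP.+-comm b e) } }
      ; *-cong = cong₂ (mulO d)
      ; *-assoc = λ { (mk a b) (mk c e) (mk f g) →
          cong₂ mk (Coordinates.*-assoc-re a b c e f g p q) (Coordinates.*-assoc-im a b c e f g p q) }
      ; *-identity = mulO-identityˡ , λ x → trans (mulO-comm x _) (mulO-identityˡ x)
      ; distrib = mulO-distribˡ-addO , λ x y z → trans (mulO-comm (addO y z) x)
          (trans (mulO-distribˡ-addO x y z) (cong₂ addO (mulO-comm x y) (mulO-comm x z))) }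
    ; *-comm = mulO-comm }

  commutativeRing : CommutativeRing _ _
  commutativeRing = record { isCommutativeRing = isCommutativeRing }

  open CommutativeRing commutativeRing
    using (_+_; _*_; _-_; 0#; 1#; distribˡ; distribʳ; *-identityʳ; +-identityˡ; zeroˡ; zeroʳ; +-group; *-commutativeSemigroup; *-semigroup)
  open Algebra.Definitions.RawSemiring (Semiring.rawSemiring (CommutativeRing.semiring commutativeRing))
    using (_^_; _∣_)
  open import Algebra.Definitions.RawMagma (CommutativeRing.*-rawMagma commutativeRing) using (_,_)
  open import Algebra.Properties.Group +-group using (x∙y⁻¹≈ε⇒x≈y)
  open import Algebra.Properties.CommutativeSemigroup *-commutativeSemigroup using (x∙yz≈y∙xz)
  open import Algebra.Properties.Semigroup.Divisibility *-semigroup using (x∣ʳy⇒x∣ʳzy)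
  open import Algebra.Properties.CommutativeSemigroup.Divisibility *-commutativeSemigroup using (x∣y⇒zx∣zy)
  open Tactic.RingSolver.NonReflective
    (fromCommutativeRing commutativeRing (λ x → Maybe.map sym (dec⇒maybe (x ≟ 0#))))
    using (solve; _⊜_; Κ; _⊕_; _⊗_; ⊝_)

  fromℤ-* : ∀ a b → fromℤ (a ℤ.* b) ≡ fromℤ a * fromℤ b
  fromℤ-* a b = sym (cong₂ mk (Coordinates.fromℤ-*-re a b p) (Coordinates.fromℤ-*-im a b q))

  conj : O → O
  conj (mk a b) = mk (a ℤ.+ q ℤ.* b) (- b)

  trace : O → ℤ
  trace (mk a b) = a ℤ.+ a ℤ.+ q ℤ.* b

  norm : O → ℤ
  norm (mk a b) = a ℤ.* a ℤ.+ q ℤ.* a ℤ.* b ℤ.- p ℤ.* b ℤ.* b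

  discriminant : ℤ
  discriminant = q ℤ.* q ℤ.+ + 4 ℤ.* p

  norm-* : ∀ x y → norm (x * y) ≡ norm x ℤ.* norm y
  norm-* (mk a b) (mk c e) = Coordinates.norm-* a b c e p q

  norm-conj : ∀ x → norm (conj x) ≡ norm x
  norm-conj (mk a b) = Coordinates.norm-conj a b p q

  norm-fromℤ : ∀ a → norm (fromℤ a) ≡ a ℤ.* a
  norm-fromℤ a = Coordinates.norm-fromℤ a p q

  *-conj : ∀ x → x * conj x ≡ fromℤ (norm x)
  *-conj (mk a b) = cong₂ mk (Coordinates.*-conj-re a b p q) (Coordinates.*-conj-im a b q)

  +-conj : ∀ x → x + conj x ≡ fromℤ (trace x)
  +-conj (mk a b) = cong₂ mk (sym (ℤP.+-assoc a a (q ℤ.* b))) (ℤP.+-inverseʳ b)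

  trace-*-conj : ∀ x y → trace (x * conj y) ≡ norm (x + y) ℤ.- norm x ℤ.- norm y
  trace-*-conj (mk a b) (mk c e) = Coordinates.trace-*-conj a b c e p q

  parallelogram : ∀ x y → norm (x + y) ℤ.+ norm (x - y) ≡ + 2 ℤ.* norm x ℤ.+ + 2 ℤ.* norm y
  parallelogram (mk a b) (mk c e) = Coordinates.parallelogram a b c e p q

  four*norm : ∀ x → + 4 ℤ.* norm x ≡ trace x ℤ.* trace x ℤ.- discriminant ℤ.* (im x ℤ.* im x)
  four*norm (mk a b) = Coordinates.four*norm a b p q

  characteristic-equation : ∀ x → x * x - fromℤ (trace x) * x + fromℤ (norm x) ≡ 0#
  characteristic-equation x = begin
    x * x - fromℤ (trace x) * x + fromℤ (norm x)
      ≡⟨ cong₂ (λ s n → x * x - s * x + n) (sym (+-conj x)) (sym (*-conj x)) ⟩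
    x * x - (x + conj x) * x + x * conj x
      ≡⟨ solve 2 (λ x x̄ → x ⊗ x ⊕ ⊝ ((x ⊕ x̄) ⊗ x) ⊕ x ⊗ x̄ ⊜ Κ 0#) refl x (conj x) ⟩
    0# ∎
    where open ≡-Reasoning

  ω²-cases : (q ≡ + 0 × p ≡ - + d) ⊎ (q ≡ + 1 × discriminant ≡ - + d × d ℕ.% 4 ≡ 3)
  ω²-cases with d ℕ.% 4 ℕ.≡ᵇ 3 in d%4≡ᵇ3
  ... | false = inj₁ (refl , refl)
  ... | true  = inj₂ (refl , 1-4k≡-d , d%4≡3)
    where
    d%4≡3 : d ℕ.% 4 ≡ 3
    d%4≡3 = ℕP.≡ᵇ⇒≡ (d ℕ.% 4) 3 (subst T (sym d%4≡ᵇ3) _)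
    k = (d ℕ.+ 1) ℕ./ 4
    k*4≡d+1 : k ℕ.* 4 ≡ d ℕ.+ 1
    k*4≡d+1 = ℕ.m/n*n≡m (ℕ.m%n≡0⇒n∣m (d ℕ.+ 1) 4
      (trans (ℕ.%-distribˡ-+ d 1 4) (cong (λ r → (r ℕ.+ 1) ℕ.% 4) d%4≡3)))
    1-4k≡-d : + 1 ℤ.* + 1 ℤ.+ + 4 ℤ.* - + k ≡ - + d
    1-4k≡-d = begin
      + 1 ℤ.* + 1 ℤ.+ + 4 ℤ.* - + k  ≡⟨ Coordinates.1-4k≡1-k*4 (+ k) ⟩
      + 1 ℤ.- + k ℤ.* + 4            ≡⟨ cong (λ n → + 1 ℤ.- n) (trans (sym (ℤP.pos-* k 4)) (cong +_ k*4≡d+1)) ⟩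
      + 1 ℤ.- + (d ℕ.+ 1)            ≡⟨ cong (λ n → + 1 ℤ.- n) (ℤP.pos-+ d 1) ⟩
      + 1 ℤ.- (+ d ℤ.+ + 1)          ≡⟨ Coordinates.1-[n+1]≡-n (+ d) ⟩
      - + d                          ∎
      where open ≡-Reasoning

  discriminant≡-4d⊎-d : discriminant ≡ - + (4 ℕ.* d) ⊎ discriminant ≡ - + d
  discriminant≡-4d⊎-d with ω²-cases
  ... | inj₁ (q≡0 , p≡-d) = inj₁ (begin
        discriminant                    ≡⟨ cong₂ (λ q p → q ℤ.* q ℤ.+ + 4 ℤ.* p) q≡0 p≡-d ⟩
        + 0 ℤ.* + 0 ℤ.+ + 4 ℤ.* - + d   ≡⟨ Coordinates.0²+4[-n]≡-[4n] (+ d) ⟩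
        - (+ 4 ℤ.* + d)                 ≡⟨ cong -_ (ℤP.pos-* 4 d) ⟨
        - + (4 ℕ.* d)                   ∎)
    where open ≡-Reasoning
  ... | inj₂ (_ , disc≡-d , _) = inj₂ disc≡-d

  binaryCubic : (c₃ c₂ c₁ c₀ x y : O) → O
  binaryCubic c₃ c₂ c₁ c₀ x y = c₃ * (x * x * x) + c₂ * (x * x * y) + c₁ * (x * y * y) + c₀ * (y * y * y)

  -- Multiplication by x maps the span of the cubic monomials in x, y into
  -- y times that span, so yᵏ divides xᵏ times each of them.
  quartic⇒y^k∣x^k*x³ : ∀ c₃ c₂ c₁ c₀ x y → x * x * x * x ≡ y * binaryCubic c₃ c₂ c₁ c₀ x y →
                       ∀ k → y ^ k ∣ x ^ k * (x * x * x)
  quartic⇒y^k∣x^k*x³ c₃ c₂ c₁ c₀ x y quartic k = Divides.proof (proj₁ (monomials k))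
    where
    -- A record rather than a definition, so that m can be inferred from Divides k m.
    record Divides (k : ℕ) (m : O) : Set where
      pattern
      constructor divides
      field proof : y ^ k ∣ x ^ k * m

    closed-+ : ∀ {k a b} → Divides k a → Divides k b → Divides k (a + b)
    closed-+ {k} {a} {b} (divides (u , u*yᵏ≡xᵏa)) (divides (v , v*yᵏ≡xᵏb)) = divides
      (u + v , trans (distribʳ (y ^ k) u v) (trans (cong₂ _+_ u*yᵏ≡xᵏa v*yᵏ≡xᵏb) (sym (distribˡ (x ^ k) a b))))

    closed-* : ∀ {k a} c → Divides k a → Divides k (c * a)
    closed-* {k} {a} c (divides yᵏ∣xᵏa) =
      divides (subst (y ^ k ∣_) (sym (x∙yz≈y∙xz (x ^ k) c a)) (x∣ʳy⇒x∣ʳzy c yᵏ∣xᵏa))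

    shift : ∀ {k w m} → Divides k w → x * x ^ k * m ≡ y * (x ^ k * w) → Divides (suc k) m
    shift {k} (divides yᵏ∣xᵏw) eq = divides (subst (y * y ^ k ∣_) (sym eq) (x∣y⇒zx∣zy y yᵏ∣xᵏw))

    monomials : ∀ k → Divides k (x * x * x) × Divides k (x * x * y) × Divides k (x * y * y) × Divides k (y * y * y)
    monomials zero = base (x * x * x) , base (x * x * y) , base (x * y * y) , base (y * y * y)
      where
      base : ∀ m → Divides zero m
      base m = divides (1# * m , *-identityʳ (1# * m))
    monomials (suc k) = step (monomials k)
      where
      step : Divides k (x * x * x) × Divides k (x * x * y) × Divides k (x * y * y) × Divides k (y * y * y) →
             Divides (suc k) (x * x * x) × Divides (suc k) (x * x * y) × Divides (suc k) (x * y * y) × Divides (suc k) (y * y * y)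
      step (d₃ , d₂ , d₁ , d₀) =
          shift (closed-+ (closed-+ (closed-+ (closed-* c₃ d₃) (closed-* c₂ d₂)) (closed-* c₁ d₁)) (closed-* c₀ d₀)) x³-step
        , shift d₃ (solve 3 (λ x X y → x ⊗ X ⊗ (x ⊗ x ⊗ y) ⊜ y ⊗ (X ⊗ (x ⊗ x ⊗ x))) refl x (x ^ k) y)
        , shift d₂ (solve 3 (λ x X y → x ⊗ X ⊗ (x ⊗ y ⊗ y) ⊜ y ⊗ (X ⊗ (x ⊗ x ⊗ y))) refl x (x ^ k) y)
        , shift d₁ (solve 3 (λ x X y → x ⊗ X ⊗ (y ⊗ y ⊗ y) ⊜ y ⊗ (X ⊗ (x ⊗ y ⊗ y))) refl x (x ^ k) y)
        where
        x³-step : x * x ^ k * (x * x * x) ≡ y * (x ^ k * binaryCubic c₃ c₂ c₁ c₀ x y)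
        x³-step = begin
          x * x ^ k * (x * x * x)                   ≡⟨ solve 2 (λ x X → x ⊗ X ⊗ (x ⊗ x ⊗ x) ⊜ X ⊗ (x ⊗ x ⊗ x ⊗ x)) refl x (x ^ k) ⟩
          x ^ k * (x * x * x * x)                   ≡⟨ cong (x ^ k *_) quartic ⟩
          x ^ k * (y * binaryCubic c₃ c₂ c₁ c₀ x y) ≡⟨ x∙yz≈y∙xz (x ^ k) y _ ⟩
          y * (x ^ k * binaryCubic c₃ c₂ c₁ c₀ x y) ∎
          where open ≡-Reasoning

  F≡x⁴-y*cubic : ∀ t x y → F d t x y ≡ x * x * x * x - y * binaryCubic t (fromℤ (+ 6)) (negO t) (negO 1#) x y
  F≡x⁴-y*cubic = solve 3 (λ t x y →
    x ⊗ x ⊗ (x ⊗ x) ⊕ ⊝ (t ⊗ (x ⊗ x ⊗ x ⊗ y)) ⊕ ⊝ (Κ (fromℤ (+ 6)) ⊗ (x ⊗ x ⊗ (y ⊗ y))) ⊕ (t ⊗ (x ⊗ (y ⊗ y ⊗ y)) ⊕ y ⊗ y ⊗ (y ⊗ y))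
    ⊜ (x ⊗ x ⊗ x ⊗ x ⊕ ⊝ (y ⊗ (t ⊗ (x ⊗ x ⊗ x) ⊕ Κ (fromℤ (+ 6)) ⊗ (x ⊗ x ⊗ y) ⊕ ⊝ t ⊗ (x ⊗ y ⊗ y) ⊕ ⊝ Κ 1# ⊗ (y ⊗ y ⊗ y))))) refl

  F≡y⁴-x*cubic : ∀ t x y → F d t x y ≡ y * y * y * y - x * binaryCubic (negO t) (fromℤ (+ 6)) t (negO 1#) y x
  F≡y⁴-x*cubic = solve 3 (λ t x y →
    x ⊗ x ⊗ (x ⊗ x) ⊕ ⊝ (t ⊗ (x ⊗ x ⊗ x ⊗ y)) ⊕ ⊝ (Κ (fromℤ (+ 6)) ⊗ (x ⊗ x ⊗ (y ⊗ y))) ⊕ (t ⊗ (x ⊗ (y ⊗ y ⊗ y)) ⊕ y ⊗ y ⊗ (y ⊗ y))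
    ⊜ (y ⊗ y ⊗ y ⊗ y ⊕ ⊝ (x ⊗ (⊝ t ⊗ (y ⊗ y ⊗ y) ⊕ Κ (fromℤ (+ 6)) ⊗ (y ⊗ y ⊗ x) ⊕ t ⊗ (y ⊗ x ⊗ x) ⊕ ⊝ Κ 1# ⊗ (x ⊗ x ⊗ x))))) refl

  -- F written in A = x² − y² and C = x·y; there the Möbius map
  -- (x, y) ↦ (x + y, x − y) becomes (A, C) ↦ (4C, A).
  F′ : O → O → O → O
  F′ t A C = A * A - fromℤ (+ 4) * (C * C) - t * (A * C)

  F≡F′ : ∀ t x y → F d t x y ≡ F′ t (x * x - y * y) (x * y)
  F≡F′ = solve 3 (λ t x y →
    x ⊗ x ⊗ (x ⊗ x) ⊕ ⊝ (t ⊗ (x ⊗ x ⊗ x ⊗ y)) ⊕ ⊝ (Κ (fromℤ (+ 6)) ⊗ (x ⊗ x ⊗ (y ⊗ y))) ⊕ (t ⊗ (x ⊗ (y ⊗ y ⊗ y)) ⊕ y ⊗ y ⊗ (y ⊗ y))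
    ⊜ (let A = x ⊗ x ⊕ ⊝ (y ⊗ y) ; C = x ⊗ y in
       A ⊗ A ⊕ ⊝ (Κ (fromℤ (+ 4)) ⊗ (C ⊗ C)) ⊕ ⊝ (t ⊗ (A ⊗ C)))) refl

  F-Möbius : ∀ t x y → F d (negO t) (x + y) (x - y) ≡ fromℤ (- + 4) * F d t x y
  F-Möbius t x y = begin
    F d (negO t) (x + y) (x - y)
      ≡⟨ F≡F′ (negO t) (x + y) (x - y) ⟩
    F′ (negO t) ((x + y) * (x + y) - (x - y) * (x - y)) ((x + y) * (x - y))
      ≡⟨ cong₂ (F′ (negO t))
           (solve 2 (λ x y → (x ⊕ y) ⊗ (x ⊕ y) ⊕ ⊝ ((x ⊕ ⊝ y) ⊗ (x ⊕ ⊝ y)) ⊜ Κ (fromℤ (+ 4)) ⊗ (x ⊗ y)) refl x y)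
           (solve 2 (λ x y → (x ⊕ y) ⊗ (x ⊕ ⊝ y) ⊜ (x ⊗ x ⊕ ⊝ (y ⊗ y))) refl x y) ⟩
    F′ (negO t) (fromℤ (+ 4) * (x * y)) (x * x - y * y)
      ≡⟨ solve 3 (λ t A C →
           (Κ (fromℤ (+ 4)) ⊗ C) ⊗ (Κ (fromℤ (+ 4)) ⊗ C) ⊕ ⊝ (Κ (fromℤ (+ 4)) ⊗ (A ⊗ A)) ⊕ ⊝ (⊝ t ⊗ (Κ (fromℤ (+ 4)) ⊗ C ⊗ A))
           ⊜ Κ (fromℤ (- + 4)) ⊗ (A ⊗ A ⊕ ⊝ (Κ (fromℤ (+ 4)) ⊗ (C ⊗ C)) ⊕ ⊝ (t ⊗ (A ⊗ C)))) refl t (x * x - y * y) (x * y) ⟩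
    fromℤ (- + 4) * F′ t (x * x - y * y) (x * y)
      ≡⟨ cong (fromℤ (- + 4) *_) (F≡F′ t x y) ⟨
    fromℤ (- + 4) * F d t x y
      ∎
    where open ≡-Reasoning

  d≡1⇒±4i : d ≡ 1 → ∀ b → ∣ b ∣ ≡ 4 → ∃[ i ] i * i ≡ fromℤ (- + 1) × mk (+ 0) b ≡ fromℤ (+ 4) * i
  d≡1⇒±4i d≡1 (+ _)    refl = mk (+ 0) (+ 1) , cong₂ (λ p q → mk (+ 0 ℤ.* + 0 ℤ.+ + 1 ℤ.* + 1 ℤ.* p)
    (+ 0 ℤ.* + 1 ℤ.+ + 1 ℤ.* + 0 ℤ.+ + 1 ℤ.* + 1 ℤ.* q)) (cong ω²-p d≡1) (cong ω²-q d≡1) , refl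
  d≡1⇒±4i d≡1 -[1+ _ ] refl = mk (+ 0) (- + 1) , cong₂ (λ p q → mk (+ 0 ℤ.* + 0 ℤ.+ - + 1 ℤ.* - + 1 ℤ.* p)
    (+ 0 ℤ.* - + 1 ℤ.+ - + 1 ℤ.* + 0 ℤ.+ - + 1 ℤ.* - + 1 ℤ.* q)) (cong ω²-p d≡1) (cong ω²-q d≡1) , refl

  module _ .{{_ : NonZero d}} where

    private
      D : ℕ
      D = ∣ discriminant ∣

      discriminant≡-D×D≢0 : discriminant ≡ - + D × D ≢ 0
      discriminant≡-D×D≢0 = [ negative (4 ℕ.* d) {{ℕP.m*n≢0 4 d}} , negative d ]′ discriminant≡-4d⊎-d
        where
        negative : ∀ n .{{_ : NonZero n}} → discriminant ≡ - + n → discriminant ≡ - + D × D ≢ 0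
        negative n disc≡-n = trans disc≡-n (cong (λ n → - + n) (sym D≡n)) , subst (_≢ 0) (sym D≡n) (ℕ.≢-nonZero⁻¹ n)
          where
          D≡n : D ≡ n
          D≡n = trans (cong ∣_∣ disc≡-n) (ℤP.∣-i∣≡∣i∣ (+ n))

      square≡+∣∣² : ∀ i → i ℤ.* i ≡ + (∣ i ∣ ℕ.* ∣ i ∣)
      square≡+∣∣² (+ n)    = sym (ℤP.pos-* n n)
      square≡+∣∣² -[1+ n ] = refl

      -n*i²+16≡0⇒n*∣i∣²≡16 : ∀ n i → - + n ℤ.* (i ℤ.* i) ℤ.+ + 16 ≡ + 0 → n ℕ.* (∣ i ∣ ℕ.* ∣ i ∣) ≡ 16
      -n*i²+16≡0⇒n*∣i∣²≡16 n i e = ℤP.+-injective (begin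
        + (n ℕ.* (∣ i ∣ ℕ.* ∣ i ∣))   ≡⟨ ℤP.pos-* n _ ⟩
        + n ℤ.* + (∣ i ∣ ℕ.* ∣ i ∣)   ≡⟨ cong (ℤ._*_ (+ n)) (square≡+∣∣² i) ⟨
        + n ℤ.* (i ℤ.* i)             ≡⟨ ℤP.neg-injective (trans (ℤP.neg-distribˡ-* (+ n) (i ℤ.* i))
                                           (Coordinates.i+j≡0⇒i≡-j _ (+ 16) e)) ⟩
        + 16                          ∎)
        where open ≡-Reasoning

    four*norm≡sum-of-squares : ∀ x → + 4 ℤ.* norm x ≡ + (∣ trace x ∣ ℕ.* ∣ trace x ∣ ℕ.+ D ℕ.* (∣ im x ∣ ℕ.* ∣ im x ∣))
    four*norm≡sum-of-squares x = begin
      + 4 ℤ.* norm x                                             ≡⟨ four*norm x ⟩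
      t ℤ.* t ℤ.- discriminant ℤ.* (b ℤ.* b)                     ≡⟨ cong (λ δ → t ℤ.* t ℤ.- δ ℤ.* (b ℤ.* b)) (proj₁ discriminant≡-D×D≢0) ⟩
      t ℤ.* t ℤ.- (- + D) ℤ.* (b ℤ.* b)                          ≡⟨ Coordinates.i-[-j]*k≡i+j*k (t ℤ.* t) (+ D) (b ℤ.* b) ⟩
      t ℤ.* t ℤ.+ + D ℤ.* (b ℤ.* b)                              ≡⟨ cong₂ (λ u v → u ℤ.+ + D ℤ.* v) (square≡+∣∣² t) (square≡+∣∣² b) ⟩
      + (∣ t ∣ ℕ.* ∣ t ∣) ℤ.+ + D ℤ.* + (∣ b ∣ ℕ.* ∣ b ∣)          ≡⟨ cong (ℤ._+_ (+ (∣ t ∣ ℕ.* ∣ t ∣))) (ℤP.pos-* D _) ⟨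
      + (∣ t ∣ ℕ.* ∣ t ∣) ℤ.+ + (D ℕ.* (∣ b ∣ ℕ.* ∣ b ∣))          ≡⟨ ℤP.pos-+ (∣ t ∣ ℕ.* ∣ t ∣) _ ⟨
      + (∣ t ∣ ℕ.* ∣ t ∣ ℕ.+ D ℕ.* (∣ b ∣ ℕ.* ∣ b ∣))             ∎
      where
      open ≡-Reasoning
      t = trace x
      b = im x

    ‖_‖ : O → ℕ
    ‖ x ‖ = ∣ norm x ∣

    norm≡+‖‖ : ∀ x → norm x ≡ + ‖ x ‖
    norm≡+‖‖ x = nonnegative (norm x) (four*norm≡sum-of-squares x)
      where
      nonnegative : ∀ i {n} → + 4 ℤ.* i ≡ + n → i ≡ + ∣ i ∣
      nonnegative (+ _)    _  = refl
      nonnegative -[1+ _ ] ()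

    ‖‖≡0⇒≡0 : ∀ x → ‖ x ‖ ≡ 0 → x ≡ 0#
    ‖‖≡0⇒≡0 (mk a b) ‖x‖≡0 = cong₂ mk a≡0 b≡0
      where
      x = mk a b
      W≡0 : ∣ trace x ∣ ℕ.* ∣ trace x ∣ ℕ.+ D ℕ.* (∣ b ∣ ℕ.* ∣ b ∣) ≡ 0
      W≡0 = ℤP.+-injective (trans (sym (four*norm≡sum-of-squares x)) (cong (+ 4 ℤ.*_) (trans (norm≡+‖‖ x) (cong +_ ‖x‖≡0))))
      ∣i∣²≡0⇒i≡0 : ∀ i → ∣ i ∣ ℕ.* ∣ i ∣ ≡ 0 → i ≡ + 0
      ∣i∣²≡0⇒i≡0 i e = ℤP.∣i∣≡0⇒i≡0 ([ id , id ]′ (ℕP.m*n≡0⇒m≡0∨n≡0 ∣ i ∣ e))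
      b≡0 : b ≡ + 0
      b≡0 = ∣i∣²≡0⇒i≡0 b ([ (λ D≡0 → contradiction D≡0 (proj₂ discriminant≡-D×D≢0)) , id ]′
              (ℕP.m*n≡0⇒m≡0∨n≡0 D (ℕP.m+n≡0⇒n≡0 (∣ trace x ∣ ℕ.* ∣ trace x ∣) W≡0)))
      a≡0 : a ≡ + 0
      a≡0 = [ (λ ()) , id ]′ (ℤP.i*j≡0⇒i≡0∨j≡0 (+ 2) (begin
        + 2 ℤ.* a                 ≡⟨ Coordinates.a+a+q*0≡2*a a q ⟨
        a ℤ.+ a ℤ.+ q ℤ.* + 0     ≡⟨ cong (λ b → a ℤ.+ a ℤ.+ q ℤ.* b) b≡0 ⟨
        trace x                   ≡⟨ ∣i∣²≡0⇒i≡0 (trace x) (ℕP.m+n≡0⇒m≡0 (∣ trace x ∣ ℕ.* ∣ trace x ∣) W≡0) ⟩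
        + 0                       ∎))
        where open ≡-Reasoning

    ‖0#‖≡0 : ‖ 0# ‖ ≡ 0
    ‖0#‖≡0 = cong ∣_∣ (norm-fromℤ (+ 0))

    ‖‖-* : ∀ x y → ‖ x * y ‖ ≡ ‖ x ‖ ℕ.* ‖ y ‖
    ‖‖-* x y = trans (cong ∣_∣ (norm-* x y)) (ℤP.abs-* (norm x) (norm y))

    ‖‖-^ : ∀ x k → ‖ x ^ k ‖ ≡ ‖ x ‖ ℕ.^ k
    ‖‖-^ x zero    = cong ∣_∣ (norm-fromℤ (+ 1))
    ‖‖-^ x (suc k) = trans (‖‖-* x (x ^ k)) (cong (‖ x ‖ ℕ.*_) (‖‖-^ x k))

    ∣⇒‖‖∣‖‖ : ∀ {x y} → x ∣ y → ‖ x ‖ ℕ.∣ ‖ y ‖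
    ∣⇒‖‖∣‖‖ {x} (u , u*x≡y) = ℕ.divides ‖ u ‖ (trans (cong ‖_‖ (sym u*x≡y)) (‖‖-* u x))

    x*y≡0⇒x≡0∨y≡0 : ∀ x y → x * y ≡ 0# → x ≡ 0# ⊎ y ≡ 0#
    x*y≡0⇒x≡0∨y≡0 x y x*y≡0 =
      Sum.map (‖‖≡0⇒≡0 x) (‖‖≡0⇒≡0 y) (ℕP.m*n≡0⇒m≡0∨n≡0 ‖ x ‖ ‖x‖*‖y‖≡0)
      where
      ‖x‖*‖y‖≡0 : ‖ x ‖ ℕ.* ‖ y ‖ ≡ 0
      ‖x‖*‖y‖≡0 = trans (sym (‖‖-* x y)) (trans (cong ‖_‖ x*y≡0) ‖0#‖≡0)

    x≢0∧x*y≡0⇒y≡0 : ∀ {x y} → x ≢ 0# → x * y ≡ 0# → y ≡ 0#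
    x≢0∧x*y≡0⇒y≡0 {x} {y} x≢0 x*y≡0 = [ (λ x≡0 → contradiction x≡0 x≢0) , id ]′ (x*y≡0⇒x≡0∨y≡0 x y x*y≡0)

    *-≢0 : ∀ {x y} → x ≢ 0# → y ≢ 0# → x * y ≢ 0#
    *-≢0 {x} {y} x≢0 y≢0 x*y≡0 = y≢0 (x≢0∧x*y≡0⇒y≡0 x≢0 x*y≡0)

    quartic⇒‖y‖∣‖x‖ : ∀ c₃ c₂ c₁ c₀ x y → x * x * x * x ≡ y * binaryCubic c₃ c₂ c₁ c₀ x y → ‖ y ‖ ℕ.∣ ‖ x ‖
    quartic⇒‖y‖∣‖x‖ c₃ c₂ c₁ c₀ x y quartic = by-cases (‖ x ‖ ℕ.≟ 0)
      where
      by-cases : Dec (‖ x ‖ ≡ 0) → ‖ y ‖ ℕ.∣ ‖ x ‖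
      by-cases (yes ‖x‖≡0) = subst (‖ y ‖ ℕ.∣_) (sym ‖x‖≡0) (‖ y ‖ ℕ.∣0)
      by-cases (no ‖x‖≢0) = ^∣^*⇒∣ (‖ x ‖ ℕ.* ‖ x ‖ ℕ.* ‖ x ‖) {{ℕP.m*n≢0 (‖ x ‖ ℕ.* ‖ x ‖) ‖ x ‖ {{ℕP.m*n≢0 ‖ x ‖ ‖ x ‖}}}} λ k →
        subst₂ ℕ._∣_ (‖‖-^ y k) (‖x^k*x³‖ k) (∣⇒‖‖∣‖‖ (quartic⇒y^k∣x^k*x³ c₃ c₂ c₁ c₀ x y quartic k))
        where
        instance
          ‖x‖-nonZero : NonZero ‖ x ‖
          ‖x‖-nonZero = ℕ.≢-nonZero ‖x‖≢0
        ‖x^k*x³‖ : ∀ k → ‖ x ^ k * (x * x * x) ‖ ≡ ‖ x ‖ ℕ.^ k ℕ.* (‖ x ‖ ℕ.* ‖ x ‖ ℕ.* ‖ x ‖)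
        ‖x^k*x³‖ k = trans (‖‖-* (x ^ k) _) (cong₂ ℕ._*_ (‖‖-^ x k)
                       (trans (‖‖-* (x * x) x) (cong (ℕ._* ‖ x ‖) (‖‖-* x x))))

    F≡0⇒‖x‖≡‖y‖ : ∀ t x y → F d t x y ≡ 0# → ‖ x ‖ ≡ ‖ y ‖
    F≡0⇒‖x‖≡‖y‖ t x y F≡0 = ℕ.∣-antisym
      (quartic⇒‖y‖∣‖x‖ (negO t) (fromℤ (+ 6)) t (negO 1#) y x (x∙y⁻¹≈ε⇒x≈y (y * y * y * y) _
        (trans (sym (F≡y⁴-x*cubic t x y)) F≡0)))
      (quartic⇒‖y‖∣‖x‖ t (fromℤ (+ 6)) (negO t) (negO 1#) x y (x∙y⁻¹≈ε⇒x≈y (x * x * x * x) _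
        (trans (sym (F≡x⁴-y*cubic t x y)) F≡0)))

    ‖‖≡⇒norm≡ : ∀ x y → ‖ x ‖ ≡ ‖ y ‖ → norm x ≡ norm y
    ‖‖≡⇒norm≡ x y ‖x‖≡‖y‖ = trans (norm≡+‖‖ x) (trans (cong +_ ‖x‖≡‖y‖) (sym (norm≡+‖‖ y)))

    F≡0⇒trace[xȳ]≡0 : ∀ t x y → F d t x y ≡ 0# → trace (x * conj y) ≡ + 0
    F≡0⇒trace[xȳ]≡0 t x y F≡0 = begin
      trace (x * conj y)                    ≡⟨ trace-*-conj x y ⟩
      norm (x + y) ℤ.- norm x ℤ.- norm y    ≡⟨ cong (λ n → norm (x + y) ℤ.- n ℤ.- norm y) Nx≡Ny ⟩
      norm (x + y) ℤ.- norm y ℤ.- norm y    ≡⟨ Coordinates.a+a≡2*n+2*n⇒a-n-n≡0 (norm (x + y)) (norm y) 2N[x+y]≡4Ny ⟩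
      + 0                                   ∎
      where
      open ≡-Reasoning
      Nx≡Ny : norm x ≡ norm y
      Nx≡Ny = ‖‖≡⇒norm≡ x y (F≡0⇒‖x‖≡‖y‖ t x y F≡0)
      N[x+y]≡N[x-y] : norm (x + y) ≡ norm (x - y)
      N[x+y]≡N[x-y] = ‖‖≡⇒norm≡ (x + y) (x - y) (F≡0⇒‖x‖≡‖y‖ (negO t) (x + y) (x - y)
        (trans (F-Möbius t x y) (trans (cong (fromℤ (- + 4) *_) F≡0) (zeroʳ (fromℤ (- + 4))))))
      2N[x+y]≡4Ny : norm (x + y) ℤ.+ norm (x + y) ≡ + 2 ℤ.* norm y ℤ.+ + 2 ℤ.* norm y
      2N[x+y]≡4Ny = trans (cong (ℤ._+_ (norm (x + y))) N[x+y]≡N[x-y])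
        (trans (parallelogram x y) (cong (λ n → + 2 ℤ.* n ℤ.+ + 2 ℤ.* norm y) Nx≡Ny))

    -- With u = x·ȳ we have ȳ²(x² + y²) = u² + N(u), the characteristic
    -- polynomial of u evaluated at u, because Tr(u) = 0 and N(u) = N(y)².
    trace[xȳ]≡0⇒x²+y²≡0 : ∀ x y → y ≢ 0# → norm x ≡ norm y → trace (x * conj y) ≡ + 0 → x * x + y * y ≡ 0#
    trace[xȳ]≡0⇒x²+y²≡0 x y y≢0 Nx≡Ny Tr≡0 = x≢0∧x*y≡0⇒y≡0 (*-≢0 ȳ≢0 ȳ≢0) (begin
      conj y * conj y * (x * x + y * y)
        ≡⟨ solve 3 (λ x y ȳ → ȳ ⊗ ȳ ⊗ (x ⊗ x ⊕ y ⊗ y) ⊜ (x ⊗ ȳ ⊗ (x ⊗ ȳ) ⊕ y ⊗ ȳ ⊗ (y ⊗ ȳ))) refl x y (conj y) ⟩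
      u * u + y * conj y * (y * conj y)
        ≡⟨ cong (λ n → u * u + n * n) (*-conj y) ⟩
      u * u + fromℤ (norm y) * fromℤ (norm y)
        ≡⟨ cong (λ n → u * u + n) (trans (sym (fromℤ-* (norm y) (norm y))) (cong fromℤ N[y]²≡N[u])) ⟩
      u * u + fromℤ (norm u)
        ≡⟨ solve 2 (λ u n → u ⊗ u ⊕ n ⊜ (u ⊗ u ⊕ ⊝ (Κ (fromℤ (+ 0)) ⊗ u) ⊕ n)) refl u (fromℤ (norm u)) ⟩
      u * u - fromℤ (+ 0) * u + fromℤ (norm u)
        ≡⟨ cong (λ τ → u * u - fromℤ τ * u + fromℤ (norm u)) Tr≡0 ⟨
      u * u - fromℤ (trace u) * u + fromℤ (norm u)
        ≡⟨ characteristic-equation u ⟩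
      0#
        ∎)
      where
      open ≡-Reasoning
      u = x * conj y
      ȳ≢0 : conj y ≢ 0#
      ȳ≢0 ȳ≡0 = y≢0 (‖‖≡0⇒≡0 y (trans (cong ∣_∣ (sym (norm-conj y))) (trans (cong ‖_‖ ȳ≡0) ‖0#‖≡0)))
      N[y]²≡N[u] : norm y ℤ.* norm y ≡ norm u
      N[y]²≡N[u] = trans (cong₂ ℤ._*_ (sym Nx≡Ny) (sym (norm-conj y))) (sym (norm-* x (conj y)))

    x²+y²≡0⇒t²+16≡0 : ∀ t x y → y ≢ 0# → F d t x y ≡ 0# → x * x + y * y ≡ 0# → t * t + fromℤ (+ 16) ≡ 0#
    x²+y²≡0⇒t²+16≡0 t x y y≢0 F≡0 x²+y²≡0 = x≢0∧x*y≡0⇒y≡0 (*-≢0 y≢0 y≢0) (begin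
      y * y * (t * t + fromℤ (+ 16))
        ≡⟨ solve 3 (λ t x y → y ⊗ y ⊗ (t ⊗ t ⊕ Κ (fromℤ (+ 16)))
             ⊜ (t ⊗ t ⊗ (x ⊗ x ⊕ y ⊗ y) ⊕ ⊝ ((t ⊗ x ⊕ Κ (fromℤ (+ 4)) ⊗ y) ⊗ (t ⊗ x ⊕ ⊝ (Κ (fromℤ (+ 4)) ⊗ y))))) refl t x y ⟩
      t * t * (x * x + y * y) - L * (t * x - fromℤ (+ 4) * y)
        ≡⟨ cong₂ (λ r l → t * t * r - l * (t * x - fromℤ (+ 4) * y)) x²+y²≡0 L≡0 ⟩
      t * t * 0# - 0# * (t * x - fromℤ (+ 4) * y)
        ≡⟨ solve 2 (λ a b → a ⊗ Κ 0# ⊕ ⊝ (Κ 0# ⊗ b) ⊜ Κ 0#) refl (t * t) (t * x - fromℤ (+ 4) * y) ⟩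
      0#
        ∎)
      where
      open ≡-Reasoning
      L = t * x + fromℤ (+ 4) * y
      Q = x * x - t * x * y - fromℤ (+ 7) * (y * y)
      F≡[x²+y²]Q+2y³L : F d t x y ≡ (x * x + y * y) * Q + fromℤ (+ 2) * (y * y * y) * L
      F≡[x²+y²]Q+2y³L = solve 3 (λ t x y →
        x ⊗ x ⊗ (x ⊗ x) ⊕ ⊝ (t ⊗ (x ⊗ x ⊗ x ⊗ y)) ⊕ ⊝ (Κ (fromℤ (+ 6)) ⊗ (x ⊗ x ⊗ (y ⊗ y))) ⊕ (t ⊗ (x ⊗ (y ⊗ y ⊗ y)) ⊕ y ⊗ y ⊗ (y ⊗ y))
        ⊜ ((x ⊗ x ⊕ y ⊗ y) ⊗ (x ⊗ x ⊕ ⊝ (t ⊗ x ⊗ y) ⊕ ⊝ (Κ (fromℤ (+ 7)) ⊗ (y ⊗ y)))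
          ⊕ Κ (fromℤ (+ 2)) ⊗ (y ⊗ y ⊗ y) ⊗ (t ⊗ x ⊕ Κ (fromℤ (+ 4)) ⊗ y))) refl t x y
      2y³L≡0 : fromℤ (+ 2) * (y * y * y) * L ≡ 0#
      2y³L≡0 = begin
        fromℤ (+ 2) * (y * y * y) * L                  ≡⟨ +-identityˡ _ ⟨
        0# + fromℤ (+ 2) * (y * y * y) * L             ≡⟨ cong (_+ fromℤ (+ 2) * (y * y * y) * L) (zeroˡ Q) ⟨
        0# * Q + fromℤ (+ 2) * (y * y * y) * L         ≡⟨ cong (λ r → r * Q + fromℤ (+ 2) * (y * y * y) * L) x²+y²≡0 ⟨
        (x * x + y * y) * Q + fromℤ (+ 2) * (y * y * y) * L ≡⟨ F≡[x²+y²]Q+2y³L ⟨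
        F d t x y                                      ≡⟨ F≡0 ⟩
        0#                                             ∎
      2≢0 : fromℤ (+ 2) ≢ 0#
      2≢0 2≡0 = contradiction (cong re 2≡0) λ ()
      L≡0 : L ≡ 0#
      L≡0 = x≢0∧x*y≡0⇒y≡0 (*-≢0 2≢0 (*-≢0 (*-≢0 y≢0 y≢0) y≢0)) 2y³L≡0

    F≡0⇒t²+16≡0 : ∀ t x y → F d t x y ≡ 0# → y ≢ 0# → t * t + fromℤ (+ 16) ≡ 0#
    F≡0⇒t²+16≡0 t x y F≡0 y≢0 = x²+y²≡0⇒t²+16≡0 t x y y≢0 F≡0
      (trace[xȳ]≡0⇒x²+y²≡0 x y y≢0 (‖‖≡⇒norm≡ x y (F≡0⇒‖x‖≡‖y‖ t x y F≡0)) (F≡0⇒trace[xȳ]≡0 t x y F≡0))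

    -- The ω-coordinate of t² + 16 is b·Tr(t) for t = a + bω, and b = 0 would
    -- leave a² + 16 = 0.
    t²+16≡0⇒trace≡0 : ∀ t → t * t + fromℤ (+ 16) ≡ 0# → trace t ≡ + 0
    t²+16≡0⇒trace≡0 (mk a b) t²+16≡0 = [ (λ b≡0 → contradiction b≡0 b≢0) , id ]′ (ℤP.i*j≡0⇒i≡0∨j≡0 b b*trace≡0)
      where
      b*trace≡0 : b ℤ.* (a ℤ.+ a ℤ.+ q ℤ.* b) ≡ + 0
      b*trace≡0 = trans (sym (Coordinates.im[t²+16] a b q)) (cong im t²+16≡0)
      b≢0 : b ≢ + 0
      b≢0 b≡0 = contradiction (ℕP.m+n≡0⇒n≡0 (∣ a ∣ ℕ.* ∣ a ∣ ℕ.+ 0) (ℤP.+-injective (trans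
        (cong (λ i → i ℤ.+ + 0 ℤ.+ + 16) (sym (square≡+∣∣² a)))
        (subst (λ b → a ℤ.* a ℤ.+ b ℤ.* b ℤ.* p ℤ.+ + 16 ≡ + 0) b≡0 (cong re t²+16≡0))))) λ ()

    -- A trace-free t is a rational multiple of √−d, so −t² = 16 reads
    -- d·k² = 16 for an integer k.
    trace≡0⇒t≡4i : SquareFree d → ∀ t → trace t ≡ + 0 → t * t + fromℤ (+ 16) ≡ 0# →
                   ∃[ i ] i * i ≡ fromℤ (- + 1) × t ≡ fromℤ (+ 4) * i
    trace≡0⇒t≡4i sf (mk a b) trace≡0 t²+16≡0 = [ q≡0-case , q≡1-case ]′ ω²-cases
      where
      re-eq : a ℤ.* a ℤ.+ b ℤ.* b ℤ.* p ℤ.+ + 16 ≡ + 0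
      re-eq = cong re t²+16≡0

      q≡0-case : q ≡ + 0 × p ≡ - + d → ∃[ i ] i * i ≡ fromℤ (- + 1) × mk a b ≡ fromℤ (+ 4) * i
      q≡0-case (q≡0 , p≡-d) =
        subst (λ a → ∃[ i ] i * i ≡ fromℤ (- + 1) × mk a b ≡ fromℤ (+ 4) * i) (sym a≡0)
          (d≡1⇒±4i (proj₁ d≡1∧∣b∣≡4) b (proj₂ d≡1∧∣b∣≡4))
        where
        open ≡-Reasoning
        a≡0 : a ≡ + 0
        a≡0 = [ (λ ()) , id ]′ (ℤP.i*j≡0⇒i≡0∨j≡0 (+ 2) (trans (sym (Coordinates.a+a+0*b≡2*a a b))
                (subst (λ q → a ℤ.+ a ℤ.+ q ℤ.* b ≡ + 0) q≡0 trace≡0)))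
        d≡1∧∣b∣≡4 : d ≡ 1 × ∣ b ∣ ≡ 4
        d≡1∧∣b∣≡4 = d*k²≡16⇒d≡1∧k≡4 d ∣ b ∣ sf (-n*i²+16≡0⇒n*∣i∣²≡16 d b (begin
          - + d ℤ.* (b ℤ.* b) ℤ.+ + 16                ≡⟨ cong (λ p → p ℤ.* (b ℤ.* b) ℤ.+ + 16) p≡-d ⟨
          p ℤ.* (b ℤ.* b) ℤ.+ + 16                    ≡⟨ cong (ℤ._+ + 16) (Coordinates.re[t²]-q≡0 b p) ⟨
          + 0 ℤ.* + 0 ℤ.+ b ℤ.* b ℤ.* p ℤ.+ + 16      ≡⟨ cong (λ a → a ℤ.* a ℤ.+ b ℤ.* b ℤ.* p ℤ.+ + 16) a≡0 ⟨
          a ℤ.* a ℤ.+ b ℤ.* b ℤ.* p ℤ.+ + 16          ≡⟨ re-eq ⟩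
          + 0                                          ∎))

      q≡1-case : q ≡ + 1 × discriminant ≡ - + d × d ℕ.% 4 ≡ 3 → ∃[ i ] i * i ≡ fromℤ (- + 1) × mk a b ≡ fromℤ (+ 4) * i
      q≡1-case (q≡1 , disc≡-d , d%4≡3) = contradiction (subst (λ d → d ℕ.% 4 ≡ 3) d≡1 d%4≡3) λ ()
        where
        open ≡-Reasoning
        b≡-[a+a] : b ≡ - (a ℤ.+ a)
        b≡-[a+a] = Coordinates.a+a+1*b≡0⇒b≡-[a+a] a b (subst (λ q → a ℤ.+ a ℤ.+ q ℤ.* b ≡ + 0) q≡1 trace≡0)
        d≡1 : d ≡ 1
        d≡1 = proj₁ (d*k²≡16⇒d≡1∧k≡4 d ∣ a ∣ sf (-n*i²+16≡0⇒n*∣i∣²≡16 d a (begin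
          - + d ℤ.* (a ℤ.* a) ℤ.+ + 16                             ≡⟨ cong (λ δ → δ ℤ.* (a ℤ.* a) ℤ.+ + 16)
                                                                         (trans (sym (cong (λ q → q ℤ.* q ℤ.+ + 4 ℤ.* p) q≡1)) disc≡-d) ⟨
          (+ 1 ℤ.* + 1 ℤ.+ + 4 ℤ.* p) ℤ.* (a ℤ.* a) ℤ.+ + 16      ≡⟨ cong (ℤ._+ + 16) (Coordinates.re[t²]-q≡1 a p) ⟨
          a ℤ.* a ℤ.+ - (a ℤ.+ a) ℤ.* - (a ℤ.+ a) ℤ.* p ℤ.+ + 16   ≡⟨ cong (λ b → a ℤ.* a ℤ.+ b ℤ.* b ℤ.* p ℤ.+ + 16) b≡-[a+a] ⟨
          a ℤ.* a ℤ.+ b ℤ.* b ℤ.* p ℤ.+ + 16                       ≡⟨ re-eq ⟩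
          + 0                                                       ∎)))

lemma3p2 : (d : ℕ) → d ≥ 1 → SquareFree d → (t : O) →
           (∀ (i : O) → mulO d i i ≡ fromℤ (- (+ 1)) → t ≢ mulO d (fromℤ (+ 4)) i) →
           (x y : O) → F d t x y ≡ 0O → (x ≡ 0O) × (y ≡ 0O)
lemma3p2 d d≥1 sf t t≢4i x y F≡0 = by-cases (y ≟ 0O)
  where
  instance
    d-nonZero : NonZero d
    d-nonZero = ℕ.>-nonZero d≥1
  open QuadraticIntegers d
  by-cases : Dec (y ≡ 0O) → (x ≡ 0O) × (y ≡ 0O)
  by-cases (yes y≡0) = ‖‖≡0⇒≡0 x (trans (F≡0⇒‖x‖≡‖y‖ t x y F≡0) (trans (cong ‖_‖ y≡0) ‖0#‖≡0)) , y≡0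
  by-cases (no y≢0)  =
    let t²+16≡0 = F≡0⇒t²+16≡0 t x y F≡0 y≢0
        i , i²≡-1 , t≡4i = trace≡0⇒t≡4i sf t (t²+16≡0⇒trace≡0 t t²+16≡0) t²+16≡0
    in  contradiction t≡4i (t≢4i i i²≡-1)
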